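{- Let $p$ be a prime with $p \equiv 3 \pmod 4$, and let \[ f^{*}_p(x) = x^p + p x^{(p+1)/2} - x + p, \qquad \widetilde{f^{*}_p}(x) = x^p f^{*}_p(1/x) = p x^p - x^{p-1} + p x^{(p-1)/2} + 1. \] Then $f^{*}_p$ and $\widetilde{f^{*}_p}$ have no common zero in $\mathbb{C}$. -}

module Defs where

open import Level using (Level; _⊔_)
open import Algebra.Bundles using (CommutativeRing; Semiring)
open import Data.Nat using (ℕ; suc; _∸_)
open import Data.Nat.DivMod using (_/_)
open import Data.Product using (∃; _×_)
open import Relation.Nullary using (¬_)
import Algebra.Definitions.RawSemiring as RS

module _ {c ℓ : Level} (R : CommutativeRing c ℓ) where
  open CommutativeRing R
  open RS (Semiring.rawSemiring semiring) using (_^_) renaming (_×_ to _·_)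

  IsField : Set (c ⊔ ℓ)
  IsField = (¬ (0# ≈ 1#)) × (∀ x → ¬ (x ≈ 0#) → ∃ λ y → (x * y) ≈ 1#)

  CharZero : Set ℓ
  CharZero = ∀ (n : ℕ) → ¬ ((suc n · 1#) ≈ 0#)

  fstar : ℕ → Carrier → Carrier
  fstar p x = ((x ^ p) + ((p · 1#) * (x ^ (suc p / 2)))) - x + (p · 1#)

  fstarRev : ℕ → Carrier → Carrier
  fstarRev p x = (((p · 1#) * (x ^ p)) - (x ^ (p ∸ 1))) + ((p · 1#) * (x ^ ((p ∸ 1) / 2))) + 1#

{-# OPTIONS --safe #-}
-- Write p = 2m + 1 and u = x^m, so that x^((p+1)/2) = x u and x^p = x u².
-- At a common zero, x f̃(x) + f(x) = p (x u + 1)², so in a field with p ≠ 0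
-- we get x u = -1. Then f(x) = 0 collapses to x^p = x, hence x² = x x^p = (x u)² = 1.
-- For p ≡ 3 (mod 4) the exponent (p+1)/2 is even, so x u = 1 = -1, impossible when 2 ≠ 0.
module Submission where

open import Defs
open import Level using (Level)
open import Algebra.Bundles using (CommutativeRing; Semiring)
open import Data.Nat as ℕ using (ℕ; zero; suc)
open import Data.Nat.DivMod using (_%_; _/_; m≡m%n+[m/n]*n; m*n/n≡m)
open import Data.Nat.Primality using (Prime)
open import Data.Nat.Tactic.RingSolver using (solve-∀)
open import Data.Product using (_×_; _,_; proj₂)
open import Relation.Binary.PropositionalEquality as ≡ using (_≡_)
open import Relation.Nullary using (¬_)
import Algebra.Definitions.RawSemiring as RawSemiringDefinitions
import Algebra.Properties.Ring as RingProperties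
import Algebra.Properties.Semiring.Exp as ExpProperties
import Algebra.Solver.Ring.NaturalCoefficients.Default as NaturalSolver
import Relation.Binary.Reasoning.Setoid as SetoidReasoning

m*2≡m+m : ∀ m → m ℕ.* 2 ≡ m ℕ.+ m
m*2≡m+m = solve-∀

m%4≡3⇒m≡[[m/4]*2+1]*2+1 : ∀ m → m % 4 ≡ 3 → m ≡ suc (suc (m / 4 ℕ.* 2) ℕ.* 2)
m%4≡3⇒m≡[[m/4]*2+1]*2+1 m m%4≡3 =
  ≡.trans (m≡m%n+[m/n]*n m 4) (≡.trans (≡.cong (ℕ._+ m / 4 ℕ.* 4) m%4≡3) (shape (m / 4)))
  where
  shape : ∀ k → 3 ℕ.+ k ℕ.* 4 ≡ suc (suc (k ℕ.* 2) ℕ.* 2)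
  shape = solve-∀

module _ {c ℓ : Level} (R : CommutativeRing c ℓ) where
  open CommutativeRing R
  open RawSemiringDefinitions (Semiring.rawSemiring semiring) using (_^_) renaming (_×_ to _·_)
  open ExpProperties semiring using (^-congʳ; ^-homo-*)
  open RingProperties ring using (+-cancelʳ; +-inverseˡ-unique; x∙y⁻¹≈ε⇒x≈y; -1*x≈-x; -‿involutive)
  open NaturalSolver commutativeSemiring using (solve; _:=_; _:+_; _:*_; con)
  open SetoidReasoning setoid

  x-y+z≈0⇒x+z≈y : ∀ x y z → x - y + z ≈ 0# → x + z ≈ y
  x-y+z≈0⇒x+z≈y x y z eq = x∙y⁻¹≈ε⇒x≈y (x + z) y (begin
    x + z - y    ≈⟨ solve 3 (λ x z y′ → x :+ z :+ y′ := x :+ y′ :+ z) refl x z (- y) ⟩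
    x - y + z    ≈⟨ eq ⟩
    0#           ∎)

  x+1≈0⇒x*x≈1 : ∀ x → x + 1# ≈ 0# → x * x ≈ 1#
  x+1≈0⇒x*x≈1 x eq = begin
    x * x         ≈⟨ *-cong x≈-1 x≈-1 ⟩
    - 1# * - 1#   ≈⟨ -1*x≈-x (- 1#) ⟩
    - - 1#        ≈⟨ -‿involutive 1# ⟩
    1#            ∎
    where
    x≈-1 : x ≈ - 1#
    x≈-1 = +-inverseˡ-unique x 1# eq

  x*x≈1⇒x^[n*2]≈1 : ∀ x → x * x ≈ 1# → ∀ n → x ^ (n ℕ.* 2) ≈ 1#
  x*x≈1⇒x^[n*2]≈1 x xx zero    = refl
  x*x≈1⇒x^[n*2]≈1 x xx (suc n) = begin
    x * (x * x ^ (n ℕ.* 2))  ≈⟨ *-congˡ (*-congˡ (x*x≈1⇒x^[n*2]≈1 x xx n)) ⟩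
    x * (x * 1#)             ≈⟨ *-congˡ (*-identityʳ x) ⟩
    x * x                    ≈⟨ xx ⟩
    1#                       ∎

  ^[m*2]≈^m*^m : ∀ x m → x ^ (m ℕ.* 2) ≈ x ^ m * x ^ m
  ^[m*2]≈^m*^m x m = trans (^-congʳ x (m*2≡m+m m)) (^-homo-* x m m)

  module OddDegree (m : ℕ) where

    p : ℕ
    p = suc (m ℕ.* 2)

    P : Carrier
    P = p · 1#

    module _ (x : Carrier) where

      u : Carrier
      u = x ^ m

      fstar≈0⇒x*u²+P*xu+P≈x : fstar R p x ≈ 0# → x * (u * u) + P * (x * u) + P ≈ x
      fstar≈0⇒x*u²+P*xu+P≈x eq = begin
        x * (u * u) + P * (x * u) + P     ≈⟨ +-congʳ (+-cong x^p≈x*u² (*-congˡ x^[[p+1]/2]≈xu)) ⟨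
        x ^ p + P * x ^ (suc p / 2) + P   ≈⟨ x-y+z≈0⇒x+z≈y _ x P eq ⟩
        x                                 ∎
        where
        x^p≈x*u² : x ^ p ≈ x * (u * u)
        x^p≈x*u² = *-congˡ (^[m*2]≈^m*^m x m)
        x^[[p+1]/2]≈xu : x ^ (suc p / 2) ≈ x * u
        x^[[p+1]/2]≈xu = ^-congʳ x (m*n/n≡m (suc m) 2)

      fstarRev≈0⇒P*xu²+P*u+1≈u² : fstarRev R p x ≈ 0# → P * (x * (u * u)) + (P * u + 1#) ≈ u * u
      fstarRev≈0⇒P*xu²+P*u+1≈u² eq = begin
        P * (x * (u * u)) + (P * u + 1#)
          ≈⟨ +-cong (*-congˡ (*-congˡ u²≈x^[p-1])) (+-congʳ (*-congˡ u≈x^[[p-1]/2])) ⟩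
        P * x ^ p + (P * x ^ (m ℕ.* 2 / 2) + 1#)
          ≈⟨ x-y+z≈0⇒x+z≈y _ _ _ (trans (sym (+-assoc _ _ _)) eq) ⟩
        x ^ (m ℕ.* 2)
          ≈⟨ u²≈x^[p-1] ⟨
        u * u ∎
        where
        u²≈x^[p-1] : u * u ≈ x ^ (m ℕ.* 2)
        u²≈x^[p-1] = sym (^[m*2]≈^m*^m x m)
        u≈x^[[p-1]/2] : u ≈ x ^ (m ℕ.* 2 / 2)
        u≈x^[[p-1]/2] = ^-congʳ x (≡.sym (m*n/n≡m m 2))

      common-zero⇒P*[xu+1]²≈0 : fstar R p x ≈ 0# → fstarRev R p x ≈ 0# → P * ((x * u + 1#) * (x * u + 1#)) ≈ 0#
      common-zero⇒P*[xu+1]²≈0 f≈0 g≈0 = +-cancelʳ (x * (u * u) + x) _ _ (begin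
        P * ((x * u + 1#) * (x * u + 1#)) + (x * (u * u) + x)
          ≈⟨ solve 3 (λ P x u → P :* ((x :* u :+ con 1) :* (x :* u :+ con 1)) :+ (x :* (u :* u) :+ x)
                             := x :* (P :* (x :* (u :* u)) :+ (P :* u :+ con 1)) :+ (x :* (u :* u) :+ P :* (x :* u) :+ P))
                   refl P x u ⟩
        x * (P * (x * (u * u)) + (P * u + 1#)) + (x * (u * u) + P * (x * u) + P)
          ≈⟨ +-cong (*-congˡ (fstarRev≈0⇒P*xu²+P*u+1≈u² g≈0)) (fstar≈0⇒x*u²+P*xu+P≈x f≈0) ⟩
        x * (u * u) + x
          ≈⟨ +-identityˡ _ ⟨
        0# + (x * (u * u) + x) ∎)

      fstar≈0⇒xu+1≈0⇒x*x≈1 : fstar R p x ≈ 0# → x * u + 1# ≈ 0# → x * x ≈ 1#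
      fstar≈0⇒xu+1≈0⇒x*x≈1 f≈0 xu+1≈0 = begin
        x * x                   ≈⟨ *-congˡ xu²≈x ⟨
        x * (x * (u * u))       ≈⟨ solve 2 (λ x u → x :* (x :* (u :* u)) := (x :* u) :* (x :* u)) refl x u ⟩
        (x * u) * (x * u)       ≈⟨ x+1≈0⇒x*x≈1 (x * u) xu+1≈0 ⟩
        1#                      ∎
        where
        xu²≈x : x * (u * u) ≈ x
        xu²≈x = begin
          x * (u * u)                       ≈⟨ +-identityʳ _ ⟨
          x * (u * u) + 0#                  ≈⟨ +-congˡ (trans (*-congˡ xu+1≈0) (zeroʳ P)) ⟨
          x * (u * u) + P * (x * u + 1#)    ≈⟨ solve 3 (λ P x u → x :* (u :* u) :+ P :* (x :* u :+ con 1)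
                                                            := x :* (u :* u) :+ P :* (x :* u) :+ P) refl P x u ⟩
          x * (u * u) + P * (x * u) + P     ≈⟨ fstar≈0⇒x*u²+P*xu+P≈x f≈0 ⟩
          x                                 ∎

  module _ (isField : IsField R) where

    x≉0⇒x*y≈0⇒y≈0 : ∀ {x y} → ¬ (x ≈ 0#) → x * y ≈ 0# → y ≈ 0#
    x≉0⇒x*y≈0⇒y≈0 {x} {y} x≉0 xy≈0 with proj₂ isField x x≉0
    ... | x⁻¹ , xx⁻¹≈1 = begin
      y               ≈⟨ *-identityˡ y ⟨
      1# * y          ≈⟨ *-congʳ xx⁻¹≈1 ⟨
      x * x⁻¹ * y     ≈⟨ solve 3 (λ x x⁻¹ y → x :* x⁻¹ :* y := x⁻¹ :* (x :* y)) refl x x⁻¹ y ⟩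
      x⁻¹ * (x * y)   ≈⟨ *-congˡ xy≈0 ⟩
      x⁻¹ * 0#        ≈⟨ zeroʳ x⁻¹ ⟩
      0#              ∎

    x*x≈0⇒¬¬x≈0 : ∀ {x} → x * x ≈ 0# → ¬ ¬ (x ≈ 0#)
    x*x≈0⇒¬¬x≈0 xx≈0 x≉0 = x≉0 (x≉0⇒x*y≈0⇒y≈0 x≉0 xx≈0)

    no-common-zero : ¬ (2 · 1# ≈ 0#) → ∀ k → let open OddDegree (suc (k ℕ.* 2)) in
      ¬ (P ≈ 0#) → ∀ x → ¬ (fstar R p x ≈ 0# × fstarRev R p x ≈ 0#)
    no-common-zero 2≉0 k P≉0 x (f≈0 , g≈0) =
      x*x≈0⇒¬¬x≈0 (x≉0⇒x*y≈0⇒y≈0 P≉0 (common-zero⇒P*[xu+1]²≈0 x f≈0 g≈0)) xu+1≉0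
      where
      open OddDegree (suc (k ℕ.* 2))

      xu+1≉0 : ¬ (x * u x + 1# ≈ 0#)
      xu+1≉0 xu+1≈0 = 2≉0 (begin
        1# + (1# + 0#)   ≈⟨ +-cong (sym xu≈1) (+-identityʳ 1#) ⟩
        x * u x + 1#     ≈⟨ xu+1≈0 ⟩
        0#               ∎)
        where
        -- x * u x unfolds to x ^ (suc k ℕ.* 2).
        xu≈1 : x * u x ≈ 1#
        xu≈1 = x*x≈1⇒x^[n*2]≈1 x (fstar≈0⇒xu+1≈0⇒x*x≈1 x f≈0 xu+1≈0) (suc k)

lemma2 : ∀ {c ℓ : Level} (K : CommutativeRing c ℓ) → IsField K → CharZero K →
    (p : ℕ) → Prime p → p % 4 ≡ 3 →
    (x : CommutativeRing.Carrier K) →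
    ¬ (CommutativeRing._≈_ K (fstar K p x) (CommutativeRing.0# K) ×
       CommutativeRing._≈_ K (fstarRev K p x) (CommutativeRing.0# K))
lemma2 K isField charZero p _ p%4≡3 x rewrite m%4≡3⇒m≡[[m/4]*2+1]*2+1 p p%4≡3 =
  no-common-zero K isField (charZero 1) (p / 4) (charZero (suc (p / 4 ℕ.* 2) ℕ.* 2)) x
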